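{- Let $t$ be a term in normal form (there is no $t'$ with $t\to t'$) such that $\emptyset;\Delta\vdash t:\rho$ for some continuation context $\Delta$ and type $\rho$ (empty variable context). Then either $t$ is a value, or $t\equiv\mathtt{throw}\,\beta\,v$ for some value $v$ and continuation variable $\beta$.
   Context: Calculus $\lambda^{::}_{\mathtt{catch}}$. Types: $\sigma,\tau,\rho ::= \mathtt{unit} \mid \mathtt{list}\,\tau \mid \sigma\to\tau$. A type is arrow-free if it contains no $\to$; $\psi$ ranges over arrow-free types. Terms: $t,r,s ::= x \mid () \mid \mathtt{nil} \mid (::) \mid \mathtt{lrec} \mid \lambda x.r \mid t\,s \mid \mathtt{catch}\,\alpha\,t \mid \mathtt{throw}\,\alpha\,t$ ($x$ variables, $\alpha,\beta$ continuation variables; $\lambda x$ binds $x$, $\mathtt{catch}\,\alpha$ binds $\alpha$; application left-associative; $t::r$ abbreviates $(::)\,t\,r$). $\mathrm{FCV}$ = free continuation variables, $t[x:=r]$ capture-avoiding substitution. Values: $v,w ::= x \mid () \mid \mathtt{nil} \mid (::) \mid (::)\,v \mid (::)\,v\,w \mid \mathtt{lrec} \mid \mathtt{lrec}\,v \mid \mathtt{lrec}\,v\,w \mid \lambda x.r$. Contexts $E ::= \Box\,t \mid v\,\Box \mid \mathtt{throw}\,\alpha\,\Box$. Reduction $\to$ is the compatible closure of: $(\lambda x.t)\,v\to t[x:=v]$; $E[\mathtt{throw}\,\alpha\,t]\to\mathtt{throw}\,\alpha\,t$; $\mathtt{catch}\,\alpha\,(\mathtt{throw}\,\alpha\,t)\to\mathtt{catch}\,\alpha\,t$;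 $\mathtt{catch}\,\alpha\,(\mathtt{throw}\,\beta\,v)\to\mathtt{throw}\,\beta\,v$ if $\alpha\notin\{\beta\}\cup\mathrm{FCV}(v)$; $\mathtt{catch}\,\alpha\,v\to v$ if $\alpha\notin\mathrm{FCV}(v)$; $\mathtt{lrec}\,v_r\,v_s\,\mathtt{nil}\to v_r$; $\mathtt{lrec}\,v_r\,v_s\,(v_h::v_t)\to v_s\,v_h\,v_t\,(\mathtt{lrec}\,v_r\,v_s\,v_t)$. Typing $\Gamma;\Delta\vdash t:\rho$ ($\Delta$ maps continuation variables to arrow-free types): $x:\rho$ if $x:\rho\in\Gamma$; $():\mathtt{unit}$; $\mathtt{nil}:\mathtt{list}\,\sigma$; $(::):\sigma\to\mathtt{list}\,\sigma\to\mathtt{list}\,\sigma$; $\mathtt{lrec}:\rho\to(\sigma\to\mathtt{list}\,\sigma\to\rho\to\rho)\to\mathtt{list}\,\sigma\to\rho$; $\lambda$-introduction and application as in simply typed $\lambda$-calculus; if $\Gamma;\Delta,\alpha:\psi\vdash t:\psi$ then $\Gamma;\Delta\vdash\mathtt{catch}\,\alpha\,t:\psi$; if $\Gamma;\Delta\vdash t:\psi$ and $\alpha:\psi\in\Delta$ then $\Gamma;\Delta\vdash\mathtt{throw}\,\alpha\,t:\tau$ for any $\tau$. -}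

module Defs where

open import Data.Nat using (ℕ; zero; suc)
open import Data.List using (List; []; _∷_)
open import Data.List.Relation.Unary.All using (All)
open import Data.Product using (∃; _×_; _,_)
open import Data.Sum using (_⊎_)
open import Relation.Binary.PropositionalEquality using (_≡_)
open import Relation.Nullary using (¬_)

infixr 5 _⇒_
data Ty : Set where
  unit : Ty
  list : Ty → Ty
  _⇒_  : Ty → Ty → Ty

data ArrowFree : Ty → Set where
  af-unit : ArrowFree unit
  af-list : ∀ {τ} → ArrowFree τ → ArrowFree (list τ)

-- Terms, de Bruijn indices for both term variables (bound by lam)
-- and continuation variables (bound by catch).

data Tm : Set where
  var   : ℕ → Tm
  ⋆     : Tm
  nil   : Tm
  cons  : Tm
  lrec  : Tm
  lam   : Tm → Tm
  app   : Tm → Tm → Tm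
  catch : Tm → Tm
  throw : ℕ → Tm → Tm

extR : (ℕ → ℕ) → ℕ → ℕ
extR ρ zero    = zero
extR ρ (suc n) = suc (ρ n)

renT : (ℕ → ℕ) → Tm → Tm
renT ρ (var x)     = var (ρ x)
renT ρ ⋆           = ⋆
renT ρ nil         = nil
renT ρ cons        = cons
renT ρ lrec        = lrec
renT ρ (lam t)     = lam (renT (extR ρ) t)
renT ρ (app t s)   = app (renT ρ t) (renT ρ s)
renT ρ (catch t)   = catch (renT ρ t)
renT ρ (throw α t) = throw α (renT ρ t)

renC : (ℕ → ℕ) → Tm → Tm
renC ρ (var x)     = var x
renC ρ ⋆           = ⋆
renC ρ nil         = nil
renC ρ cons        = cons
renC ρ lrec        = lrec
renC ρ (lam t)     = lam (renC ρ t)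
renC ρ (app t s)   = app (renC ρ t) (renC ρ s)
renC ρ (catch t)   = catch (renC (extR ρ) t)
renC ρ (throw α t) = throw (ρ α) (renC ρ t)

extsT : (ℕ → Tm) → ℕ → Tm
extsT σ zero    = var zero
extsT σ (suc n) = renT suc (σ n)

substT : (ℕ → Tm) → Tm → Tm
substT σ (var x)     = σ x
substT σ ⋆           = ⋆
substT σ nil         = nil
substT σ cons        = cons
substT σ lrec        = lrec
substT σ (lam t)     = lam (substT (extsT σ) t)
substT σ (app t s)   = app (substT σ t) (substT σ s)
substT σ (catch t)   = catch (substT (λ n → renC suc (σ n)) t)
substT σ (throw α t) = throw α (substT σ t)

sub0 : Tm → ℕ → Tm
sub0 s zero    = s
sub0 s (suc n) = var n

_[0:=_] : Tm → Tm → Tm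
t [0:= s ] = substT (sub0 s) t

data Value : Tm → Set where
  v-var    : ∀ x → Value (var x)
  v-unit   : Value ⋆
  v-nil    : Value nil
  v-cons0  : Value cons
  v-cons1  : ∀ {v} → Value v → Value (app cons v)
  v-cons2  : ∀ {v w} → Value v → Value w → Value (app (app cons v) w)
  v-lrec0  : Value lrec
  v-lrec1  : ∀ {v} → Value v → Value (app lrec v)
  v-lrec2  : ∀ {v w} → Value v → Value w → Value (app (app lrec v) w)
  v-lam    : ∀ r → Value (lam r)

-- With de Bruijn continuation variables, "α ∉ FCV(u)" for the bound
-- α = 0 of catch, together with reading u outside the binder, is
-- expressed by writing the body as  renC suc u  (u is then the
-- same term seen outside the binder).

infix 4 _⟶_
data _⟶_ : Tm → Tm → Set where
  β-lam    : ∀ {t v} → Value v → app (lam t) v ⟶ t [0:= v ]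
  -- E[throw α t] → throw α t, for E ::= □ t | v □ | throw α □
  thr-appL : ∀ {α t s} → app (throw α t) s ⟶ throw α t
  thr-appR : ∀ {v α t} → Value v → app v (throw α t) ⟶ throw α t
  thr-thr  : ∀ {β α t} → throw β (throw α t) ⟶ throw α t
  catch-thr-same : ∀ {t} → catch (throw zero t) ⟶ catch t
  -- catch α (throw β v) → throw β v  if α ∉ {β} ∪ FCV(v)
  catch-thr-other : ∀ {β v} → Value v →
    catch (throw (suc β) (renC suc v)) ⟶ throw β v
  -- catch α v → v  if α ∉ FCV(v)
  catch-val : ∀ {v} → Value v → catch (renC suc v) ⟶ v
  lrec-nil  : ∀ {vr vs} → Value vr → Value vs →
    app (app (app lrec vr) vs) nil ⟶ vr
  lrec-cons : ∀ {vr vs vh vt} → Value vr → Value vs → Value vh → Value vt →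
    app (app (app lrec vr) vs) (app (app cons vh) vt)
      ⟶ app (app (app vs vh) vt) (app (app (app lrec vr) vs) vt)
  ξ-lam   : ∀ {t t'} → t ⟶ t' → lam t ⟶ lam t'
  ξ-appL  : ∀ {t t' s} → t ⟶ t' → app t s ⟶ app t' s
  ξ-appR  : ∀ {t s s'} → s ⟶ s' → app t s ⟶ app t s'
  ξ-catch : ∀ {t t'} → t ⟶ t' → catch t ⟶ catch t'
  ξ-throw : ∀ {α t t'} → t ⟶ t' → throw α t ⟶ throw α t'

NormalForm : Tm → Set
NormalForm t = ∀ t' → ¬ (t ⟶ t')

-- Typing  Γ ; Δ ⊢ t ∶ ρ   (contexts as lists, index 0 = most recent)

infix 4 _∋_∶_
data _∋_∶_ : List Ty → ℕ → Ty → Set where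
  here  : ∀ {Γ ρ} → (ρ ∷ Γ) ∋ zero ∶ ρ
  there : ∀ {Γ ρ σ n} → Γ ∋ n ∶ ρ → (σ ∷ Γ) ∋ suc n ∶ ρ

infix 4 _⨾_⊢_∶_
data _⨾_⊢_∶_ : List Ty → List Ty → Tm → Ty → Set where
  ⊢var   : ∀ {Γ Δ x ρ} → Γ ∋ x ∶ ρ → Γ ⨾ Δ ⊢ var x ∶ ρ
  ⊢unit  : ∀ {Γ Δ} → Γ ⨾ Δ ⊢ ⋆ ∶ unit
  ⊢nil   : ∀ {Γ Δ σ} → Γ ⨾ Δ ⊢ nil ∶ list σ
  ⊢cons  : ∀ {Γ Δ σ} → Γ ⨾ Δ ⊢ cons ∶ σ ⇒ list σ ⇒ list σ
  ⊢lrec  : ∀ {Γ Δ ρ σ} →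
    Γ ⨾ Δ ⊢ lrec ∶ ρ ⇒ (σ ⇒ list σ ⇒ ρ ⇒ ρ) ⇒ list σ ⇒ ρ
  ⊢lam   : ∀ {Γ Δ σ τ r} → (σ ∷ Γ) ⨾ Δ ⊢ r ∶ τ → Γ ⨾ Δ ⊢ lam r ∶ σ ⇒ τ
  ⊢app   : ∀ {Γ Δ σ τ t s} → Γ ⨾ Δ ⊢ t ∶ σ ⇒ τ → Γ ⨾ Δ ⊢ s ∶ σ →
    Γ ⨾ Δ ⊢ app t s ∶ τ
  ⊢catch : ∀ {Γ Δ ψ t} → ArrowFree ψ → Γ ⨾ (ψ ∷ Δ) ⊢ t ∶ ψ →
    Γ ⨾ Δ ⊢ catch t ∶ ψ
  ⊢throw : ∀ {Γ Δ ψ τ α t} → Γ ⨾ Δ ⊢ t ∶ ψ → Δ ∋ α ∶ ψ →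
    Γ ⨾ Δ ⊢ throw α t ∶ τ

ContCtx : List Ty → Set
ContCtx Δ = All ArrowFree Δ

module Submission where

-- A closed normal term is analysed by induction on its typing derivation:
-- every non-value redex shape (β, lrec on a canonical list, a throw in an
-- evaluation context, catch around a value or a throw) would be a step.
-- The catch cases need that a closed value of arrow-free type is built from
-- (), nil and (::) only, so it contains no continuation variable and the
-- side condition α ∉ FCV(v) of the catch rules holds automatically.

open import Defs
open import Data.Nat using (zero; suc)
open import Data.List using (List; [])
open import Data.List.Relation.Unary.All using (_∷_)
open import Data.Product using (∃-syntax; _×_; _,_)
open import Data.Sum using (_⊎_; inj₁; inj₂)
open import Data.Empty using (⊥-elim)
open import Relation.Binary.PropositionalEquality using (_≡_; refl; cong₂; subst)

ValueOrThrow : Tm → Set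
ValueOrThrow t = Value t ⊎ (∃[ β ] ∃[ v ] (Value v × t ≡ throw β v))

normalForm-inner : ∀ {F : Tm → Tm} {t} →
  (∀ {s s'} → s ⟶ s' → F s ⟶ F s') → NormalForm (F t) → NormalForm t
normalForm-inner ξ nf t' t⟶t' = nf _ (ξ t⟶t')

∋-arrowFree : ∀ {Δ α ψ} → ContCtx Δ → Δ ∋ α ∶ ψ → ArrowFree ψ
∋-arrowFree (af ∷ _)   here      = af
∋-arrowFree (_  ∷ afs) (there α) = ∋-arrowFree afs α

renC-closedArrowFreeValue : ∀ {Δ v ψ} → [] ⨾ Δ ⊢ v ∶ ψ → ArrowFree ψ → Value v →
  ∀ f → renC f v ≡ v
renC-closedArrowFreeValue ⊢unit _ v-unit f = refl
renC-closedArrowFreeValue ⊢nil  _ v-nil  f = refl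
renC-closedArrowFreeValue (⊢app (⊢app ⊢cons ⊢h) ⊢t) (af-list af) (v-cons2 vh vt) f =
  cong₂ (λ h t → app (app cons h) t)
    (renC-closedArrowFreeValue ⊢h af vh f)
    (renC-closedArrowFreeValue ⊢t (af-list af) vt f)
renC-closedArrowFreeValue (⊢var ()) _ (v-var _) f
renC-closedArrowFreeValue ⊢cons () v-cons0 f
renC-closedArrowFreeValue (⊢app ⊢cons _) () (v-cons1 _) f
renC-closedArrowFreeValue ⊢lrec () v-lrec0 f
renC-closedArrowFreeValue (⊢app ⊢lrec _) () (v-lrec1 _) f
renC-closedArrowFreeValue (⊢app (⊢app ⊢lrec _) _) () (v-lrec2 _ _) f
renC-closedArrowFreeValue (⊢lam _) () (v-lam _) f

canonical-list : ∀ {Δ v σ} → [] ⨾ Δ ⊢ v ∶ list σ → Value v →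
  v ≡ nil ⊎ ∃[ h ] ∃[ t ] (Value h × Value t × v ≡ app (app cons h) t)
canonical-list ⊢nil v-nil = inj₁ refl
canonical-list (⊢app (⊢app ⊢cons _) _) (v-cons2 vh vt) = inj₂ (_ , _ , vh , vt , refl)
canonical-list (⊢var ()) (v-var _)

normalApp-value : ∀ {Δ t s σ τ} → [] ⨾ Δ ⊢ t ∶ σ ⇒ τ → [] ⨾ Δ ⊢ s ∶ σ →
  Value t → Value s → NormalForm (app t s) → Value (app t s)
normalApp-value (⊢var ()) _ (v-var _) _ _
normalApp-value _ _ v-cons0 vs _ = v-cons1 vs
normalApp-value _ _ (v-cons1 vh) vs _ = v-cons2 vh vs
normalApp-value (⊢app (⊢app () _) _) _ (v-cons2 _ _) _ _
normalApp-value _ _ v-lrec0 vs _ = v-lrec1 vs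
normalApp-value _ _ (v-lrec1 vr) vs _ = v-lrec2 vr vs
normalApp-value (⊢app (⊢app ⊢lrec _) _) ⊢s (v-lrec2 vr vf) vs nf
  with canonical-list ⊢s vs
... | inj₁ refl = ⊥-elim (nf _ (lrec-nil vr vf))
... | inj₂ (_ , _ , vh , vt , refl) = ⊥-elim (nf _ (lrec-cons vr vf vh vt))
normalApp-value _ _ (v-lam _) vs nf = ⊥-elim (nf _ (β-lam vs))

normal-valueOrThrow : ∀ {Δ t ρ} → ContCtx Δ → NormalForm t → [] ⨾ Δ ⊢ t ∶ ρ →
  ValueOrThrow t
normal-valueOrThrow _ _ (⊢var ())
normal-valueOrThrow _ _ ⊢unit = inj₁ v-unit
normal-valueOrThrow _ _ ⊢nil  = inj₁ v-nil
normal-valueOrThrow _ _ ⊢cons = inj₁ v-cons0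
normal-valueOrThrow _ _ ⊢lrec = inj₁ v-lrec0
normal-valueOrThrow _ _ (⊢lam {r = r} _) = inj₁ (v-lam r)
normal-valueOrThrow afs nf (⊢app ⊢t ⊢s)
  with normal-valueOrThrow afs (normalForm-inner ξ-appL nf) ⊢t
     | normal-valueOrThrow afs (normalForm-inner ξ-appR nf) ⊢s
... | inj₂ (_ , _ , _ , refl) | _ = ⊥-elim (nf _ thr-appL)
... | inj₁ vt | inj₂ (_ , _ , _ , refl) = ⊥-elim (nf _ (thr-appR vt))
... | inj₁ vt | inj₁ vs = inj₁ (normalApp-value ⊢t ⊢s vt vs nf)
normal-valueOrThrow afs nf (⊢catch {t = t} af ⊢t)
  with normal-valueOrThrow (af ∷ afs) (normalForm-inner ξ-catch nf) ⊢t
... | inj₁ vt =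
  ⊥-elim (nf _ (subst (λ u → catch u ⟶ t)
    (renC-closedArrowFreeValue ⊢t af vt suc) (catch-val vt)))
... | inj₂ (zero , _ , _ , refl) = ⊥-elim (nf _ catch-thr-same)
normal-valueOrThrow afs nf (⊢catch af (⊢throw ⊢v (there α)))
  | inj₂ (suc β , v , vv , refl) =
  ⊥-elim (nf _ (subst (λ u → catch (throw (suc β) u) ⟶ throw β v)
    (renC-closedArrowFreeValue ⊢v (∋-arrowFree afs α) vv suc) (catch-thr-other vv)))
normal-valueOrThrow afs nf (⊢throw {α = α} {t = t} ⊢t _)
  with normal-valueOrThrow afs (normalForm-inner ξ-throw nf) ⊢t
... | inj₁ vt = inj₂ (α , t , vt , refl)
... | inj₂ (_ , _ , _ , refl) = ⊥-elim (nf _ thr-thr)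

lemma2p14 : (Δ : List Ty) → ContCtx Δ → (t : Tm) → (ρ : Ty) →
    NormalForm t → [] ⨾ Δ ⊢ t ∶ ρ →
    Value t ⊎ (∃[ β ] ∃[ v ] (Value v × t ≡ throw β v))
lemma2p14 Δ afs t ρ nf ⊢t = normal-valueOrThrow afs nf ⊢t
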